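{- For any graph $G$, $$\gamma_{\rm sp}(G)\ge \gamma_s(G).$$
   Context: All graphs are finite, simple and undirected. For a vertex $v$ of a graph $G$, $N(v)$ denotes the set of vertices adjacent to $v$. For $D\subseteq V(G)$ write $\overline{D}=V(G)\setminus D$. A set $D\subseteq V(G)$ is dominating if every vertex of $\overline{D}$ has a neighbour in $D$. A set $D\subseteq V(G)$ is a super dominating set of $G$ if for every $u\in\overline{D}$ there exists $v\in D$ such that $N(v)\cap\overline{D}=\{u\}$; the super domination number $\gamma_{\rm sp}(G)$ is the minimum cardinality of a super dominating set of $G$. A set $S\subseteq V(G)$ is a secure dominating set of $G$ if it is dominating and for every $v\in\overline{S}$ there exists $u\in N(v)\cap S$ such that $(S\setminus\{u\})\cup\{v\}$ is dominating; the secure domination number $\gamma_s(G)$ is the minimum cardinality of a secure dominating set of $G$. -}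

module Defs where

open import Data.Nat using (ℕ; _≤_)
open import Data.Fin using (Fin)
open import Data.Fin.Subset using (Subset; _∈_; _∉_; ∣_∣; _∪_; ⁅_⁆; ∁)
open import Data.Fin.Subset using () renaming (_─_ to _minus_)
open import Data.Product using (Σ; ∃; ∃-syntax; _×_; _,_)
open import Relation.Nullary using (¬_)
open import Relation.Binary.PropositionalEquality using (_≡_)

record Graph (n : ℕ) : Set₁ where
  field
    Adj   : Fin n → Fin n → Set
    sym   : ∀ {u v} → Adj u v → Adj v u
    irrefl : ∀ {v} → ¬ Adj v v
open Graph public

module _ {n : ℕ} (G : Graph n) where

  IsDominating : Subset n → Set
  IsDominating D = ∀ u → u ∉ D → ∃[ v ] (v ∈ D × Adj G v u)

  PrivateNbr : Subset n → Fin n → Fin n → Set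
  PrivateNbr D v u = (u ∉ D × Adj G v u) × (∀ w → w ∉ D → Adj G v w → w ≡ u)

  IsSuperDominating : Subset n → Set
  IsSuperDominating D = ∀ u → u ∉ D → ∃[ v ] (v ∈ D × PrivateNbr D v u)

  IsSecureDominating : Subset n → Set
  IsSecureDominating S =
    IsDominating S ×
    (∀ v → v ∉ S → ∃[ u ] (u ∈ S × Adj G v u ×
       IsDominating ((S minus ⁅ u ⁆) ∪ ⁅ v ⁆)))

  IsMinCard : (Subset n → Set) → ℕ → Set
  IsMinCard P k = (∃[ S ] (P S × ∣ S ∣ ≡ k)) × (∀ S → P S → k ≤ ∣ S ∣)

  IsSuperDominationNumber : ℕ → Set
  IsSuperDominationNumber = IsMinCard IsSuperDominating

  IsSecureDominationNumber : ℕ → Set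
  IsSecureDominationNumber = IsMinCard IsSecureDominating

-- Every super dominating set D is already secure: a vertex v ∉ D has a neighbour
-- u ∈ D whose only neighbour outside D is v, so exchanging u for v leaves every
-- other outside vertex w with its own private neighbour in D, which cannot be u.
module Submission where

open import Defs
open import Data.Nat using (ℕ; _≤_)
open import Data.Fin using (Fin)
open import Data.Fin.Properties using (_≟_)
open import Data.Fin.Subset using (Subset; _∈_; _∉_; _∪_; ⁅_⁆; _─_)
open import Data.Fin.Subset.Properties using (x∈⁅x⁆; x∈⁅y⁆⇒x≡y; x∈p∪q⁺; x∈p∧x∉q⇒x∈p─q)
open import Data.Product using (∃-syntax; _×_; _,_)
open import Data.Sum using (inj₁; inj₂)
open import Relation.Nullary using (yes; no)
open import Relation.Binary.PropositionalEquality using (_≢_; refl)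
open import Data.Empty using (⊥-elim)

module _ {n : ℕ} where

  exchange : Subset n → Fin n → Fin n → Subset n
  exchange D u v = (D ─ ⁅ u ⁆) ∪ ⁅ v ⁆

  ∈-exchange-new : ∀ D u v → v ∈ exchange D u v
  ∈-exchange-new D u v = x∈p∪q⁺ (inj₂ (x∈⁅x⁆ v))

  ∈-exchange-kept : ∀ {D u v x} → x ∈ D → x ≢ u → x ∈ exchange D u v
  ∈-exchange-kept {u = u} x∈D x≢u =
    x∈p∪q⁺ (inj₁ (x∈p∧x∉q⇒x∈p─q x∈D (λ x∈⁅u⁆ → x≢u (x∈⁅y⁆⇒x≡y u x∈⁅u⁆))))

  ∉-exchange⇒∉ : ∀ {D u v w} → w ∉ exchange D u v → w ≢ u → w ∉ D
  ∉-exchange⇒∉ w∉E w≢u w∈D = w∉E (∈-exchange-kept w∈D w≢u)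

module _ {n : ℕ} (G : Graph n) where

  minCard-mono : ∀ {P Q : Subset n → Set} {p q} → (∀ S → P S → Q S) →
                 IsMinCard G P p → IsMinCard G Q q → q ≤ p
  minCard-mono P⇒Q ((S , PS , refl) , _) (_ , Q-min) = Q-min S (P⇒Q S PS)

  superDominating⇒dominating : ∀ {D} → IsSuperDominating G D → IsDominating G D
  superDominating⇒dominating sd u u∉D with sd u u∉D
  ... | v , v∈D , (_ , Avu) , _ = v , v∈D , Avu

  exchange-privateNbr-dominating : ∀ {D u v} → IsSuperDominating G D →
    u ∈ D → PrivateNbr G D u v → IsDominating G (exchange D u v)
  exchange-privateNbr-dominating {D} {u} {v} sd u∈D ((_ , Auv) , only-v) w w∉E
    with w ≟ u
  ... | yes refl = v , ∈-exchange-new D u v , Graph.sym G Auv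
  ... | no w≢u with w ≟ v
  ...   | yes refl = ⊥-elim (w∉E (∈-exchange-new D u v))
  ...   | no w≢v = dominator (sd w w∉D)
    where
    w∉D : w ∉ D
    w∉D = ∉-exchange⇒∉ w∉E w≢u

    dominator : ∃[ x ] (x ∈ D × PrivateNbr G D x w) →
                ∃[ x ] (x ∈ exchange D u v × Adj G x w)
    dominator (x , x∈D , (_ , Axw) , _) with x ≟ u
    ... | yes refl = ⊥-elim (w≢v (only-v w w∉D Axw))
    ... | no x≢u = x , ∈-exchange-kept x∈D x≢u , Axw

  superDominating⇒secureDominating : ∀ {D} → IsSuperDominating G D → IsSecureDominating G D
  superDominating⇒secureDominating {D} sd = superDominating⇒dominating sd , secure
    where
    secure : ∀ v → v ∉ D → ∃[ u ] (u ∈ D × Adj G v u × IsDominating G (exchange D u v))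
    secure v v∉D with sd v v∉D
    ... | u , u∈D , uPv@((_ , Auv) , _) =
      u , u∈D , Graph.sym G Auv , exchange-privateNbr-dominating sd u∈D uPv

theorem8 : ∀ {n : ℕ} (G : Graph n) (γsp γs : ℕ) →
    IsSuperDominationNumber G γsp → IsSecureDominationNumber G γs → γs ≤ γsp
theorem8 G γsp γs = minCard-mono G (λ _ → superDominating⇒secureDominating G)
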